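{- Let $m,h$ be integers with $m \geq 2$ and $1 \leq h \leq m-1$, and let $S := \langle m, m+1, \ldots, m+h \rangle$ be the numerical semigroup generated by $m, m+1, \ldots, m+h$. Put $\lambda := \left\lceil \frac{m-2}{2h} \right\rceil$. Then $\lambda m \in S \cap [0,c(S)]$, the function $\sigma$ attains its maximum over $S \cap [0, c(S)]$ at $\lambda m$, and $$\sigma(\lambda m) = \lambda\left(\frac{m}{2} - 1\right) - h\binom{\lambda}{2}.$$
   Context: A numerical semigroup is a subset $S \subseteq \mathbb{N} = \{0,1,2,\ldots\}$ closed under addition, containing $0$, with finite complement. Its Frobenius number is $F(S) := \max(\mathbb{N}\setminus S)$ and its conductor is $c(S) := F(S)+1$. For $s \in S \cap [0,c(S)]$ define $\sigma(s) := \frac{s}{2} - |S \cap [0,s]| + 1$. The maximum of $\sigma$ over $S\cap[0,c(S)]$ is called the Clifford defect of $S$. -}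

module Defs where

open import Data.Nat using (ℕ; zero; suc; _+_; _*_; _∸_; _≤_; _<_; _≤?_; _<?_; z<s; s≤s)
open import Data.Nat.Properties using (m+[n∸m]≡n; m+n∸m≡n; m≤m+n; ∸-monoʳ-<; ≤-refl)
open import Data.Nat.DivMod using (_/_)
open import Data.Nat.Induction using (<-rec)
open import Data.List using (List; []; _∷_; length; filter; upTo; applyUpTo)
open import Data.List.Membership.Propositional using (_∈_)
open import Data.List.Relation.Unary.Any using (here; there)
open import Data.Product using (Σ; _×_; _,_; ∃)
open import Data.Sum using (_⊎_; inj₁; inj₂)
open import Data.Empty using (⊥)
open import Relation.Nullary using (Dec; yes; no; ¬_)
open import Relation.Binary.PropositionalEquality using (_≡_; refl; subst; sym; trans; cong)
open import Data.Integer using (+_)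
open import Data.Rational using (ℚ; _-_; 1ℚ)
  renaming (_/_ to _÷_)

data _∈⟨_⟩ : ℕ → List ℕ → Set where
  zero∈ : ∀ {gs} → 0 ∈⟨ gs ⟩
  step  : ∀ {gs g x} → g ∈ gs → x ∈⟨ gs ⟩ → (g Data.Nat.+ x) ∈⟨ gs ⟩

private
  inv : ∀ {gs x} → x ∈⟨ gs ⟩ → x ≡ 0 ⊎ Σ ℕ λ g → Σ ℕ λ y →
        g ∈ gs × 0 < g × y ∈⟨ gs ⟩ × g Data.Nat.+ y ≡ x
  inv zero∈ = inj₁ refl
  inv (step {g = zero} g∈ y∈) = inv y∈
  inv (step {g = suc g} {x = y} g∈ y∈) = inj₂ (suc g , y , g∈ , z<s , y∈ , refl)

  module _ (gs : List ℕ) (x : ℕ) (rec : ∀ {y} → y < x → Dec (y ∈⟨ gs ⟩)) where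
    Good : ℕ → Set
    Good g = 0 < g × Σ (g ≤ x) λ _ → (x ∸ g) ∈⟨ gs ⟩

    good? : ∀ g → Dec (Good g)
    good? g with 0 <? g | g ≤? x
    ... | no ¬p | _ = no λ { (p , _) → ¬p p }
    ... | yes p | no ¬q = no λ { (_ , q , _) → ¬q q }
    ... | yes p | yes q with rec {x ∸ g} (∸-monoʳ-< p q)
    ...   | yes r = yes (p , q , r)
    ...   | no ¬r = no λ { (_ , _ , r) → ¬r r }

    search : (hs : List ℕ) → Dec (Σ ℕ λ g → g ∈ hs × Good g)
    search [] = no λ { (_ , () , _) }
    search (h ∷ hs) with good? h | search hs
    ... | yes gd | _ = yes (h , here refl , gd)
    ... | no _ | yes (g , g∈ , gd) = yes (g , there g∈ , gd)
    ... | no ¬gd | no ¬s = no λ { (g , here refl , gd) → ¬gd gd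
                               ; (g , there g∈ , gd) → ¬s (g , g∈ , gd) }

  step-dec : (gs : List ℕ) (x : ℕ) → (∀ {y} → y < x → Dec (y ∈⟨ gs ⟩)) → Dec (x ∈⟨ gs ⟩)
  step-dec gs zero rec = yes zero∈
  step-dec gs (suc n) rec with search gs (suc n) rec gs
  ... | yes (g , g∈ , (p , q , r)) =
        yes (subst (_∈⟨ gs ⟩) (m+[n∸m]≡n q) (step g∈ r))
  ... | no ¬s = no λ mem → helper (inv mem)
    where
    helper : _ → ⊥
    helper (inj₁ ())
    helper (inj₂ (g , y , g∈ , p , y∈ , eq)) =
      ¬s (g , g∈ , p , subst (g ≤_) eq (m≤m+n g y) ,
          subst (_∈⟨ gs ⟩) (trans (sym (m+n∸m≡n g y)) (cong (_∸ g) eq)) y∈)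

_∈⟨_⟩? : (x : ℕ) (gs : List ℕ) → Dec (x ∈⟨ gs ⟩)
x ∈⟨ gs ⟩? = <-rec (λ y → Dec (y ∈⟨ gs ⟩)) (step-dec gs) x

-- F is the Frobenius number of ⟨ gs ⟩: F ∉ S and every n > F lies in S
-- (i.e. F = max (ℕ ∖ S)).  The conductor is then c(S) = F + 1.
IsFrobenius : List ℕ → ℕ → Set
IsFrobenius gs F = ¬ (F ∈⟨ gs ⟩) × (∀ n → F < n → n ∈⟨ gs ⟩)

countUpTo : List ℕ → ℕ → ℕ
countUpTo gs s = length (filter (λ x → x ∈⟨ gs ⟩?) (upTo (suc s)))

σ : List ℕ → ℕ → ℚ
σ gs s = ((+ s) ÷ 2 - (+ countUpTo gs s) ÷ 1) Data.Rational.+ 1ℚ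

intervalGens : ℕ → ℕ → List ℕ
intervalGens m h = applyUpTo (m Data.Nat.+_) (suc h)

-- ⌈ a / b ⌉ for b ≥ 1 (value at b = 0 is an irrelevant convention)
ceilDiv : ℕ → ℕ → ℕ
ceilDiv a zero = 0
ceilDiv a (suc b) = (a Data.Nat.+ b) / suc b

-- Write m = a + 2. The elements of S = ⟨m, …, m + h⟩ are exactly the numbers k m + t with
-- t ≤ k h, so S is a union of blocks [k m, k m + k h] separated by gaps until the blocks start
-- to overlap. This gives the Frobenius number q m + (m − 1), where q h < m − 1 ≤ (q + 1) h, and
-- |S ∩ [0, k m + t]| = k + h C(k,2) + t + 1 below the conductor. Hence
-- 2σ(k m + t) = k a − 2h C(k,2) − t, which is largest for t = 0 and k = λ, since
-- k ↦ k a − 2h C(k,2) increases exactly as long as 2h k < a.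
module Submission where

open import Defs
open import Data.Nat using (ℕ; suc; _≤_; _∸_)
open import Data.Nat.Combinatorics using (_C_)
open import Data.Product using (Σ; _×_)
open import Data.Integer using (+_)
open import Data.Rational using (ℚ; _-_; 1ℚ)
open import Relation.Binary.PropositionalEquality using (_≡_)

open import Data.Nat using (zero; _+_; _*_; _<_; NonZero; z≤n; s≤s)
open import Data.Nat.Properties
open import Data.Nat.DivMod using (_/_; _%_; m≡m%n+[m/n]*n; m%n<n; m/n*n≤m; /-monoˡ-≤; m*n/n≡m)
open import Data.Nat.Combinatorics using (nC1≡n; nCk+nC[k+1]≡[n+1]C[k+1])
open import Data.Nat.Tactic.RingSolver using (solve-∀)
open import Data.List using ([]; _∷_; length; filter; upTo)
open import Data.List.Properties using (upTo-∷ʳ; filter-++; length-++; filter-accept; filter-reject)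
open import Data.List.Membership.Propositional.Properties using (∈-applyUpTo⁺; ∈-applyUpTo⁻)
open import Data.Product using (_,_; ∃; ∃₂)
open import Data.Sum using (inj₁; inj₂)
open import Function using (_∘_)
open import Relation.Nullary using (¬_; yes; no)
open import Relation.Unary using (Pred; Decidable)
open import Relation.Binary.PropositionalEquality
  using (refl; sym; trans; cong; cong₂; subst; subst₂; module ≡-Reasoning)
import Data.Integer as ℤ
import Data.Integer.Properties as ℤ
open import Data.Rational as ℚ using (½; toℚᵘ)
import Data.Rational.Properties as ℚ
import Data.Rational.Unnormalised as ℚᵘ
import Data.Rational.Unnormalised.Properties as ℚᵘ
open import Data.Rational.Solver using (module +-*-Solver)

ι : ℕ → ℚ
ι n = + n ℚ./ 1

toℚᵘ-ι : ∀ n → toℚᵘ (ι n) ℚᵘ.≃ ℚᵘ.mkℚᵘ (+ n) 0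
toℚᵘ-ι n = ℚ.toℚᵘ-fromℚᵘ (ℚᵘ.mkℚᵘ (+ n) 0)

ι-+ : ∀ a b → ι (a + b) ≡ ι a ℚ.+ ι b
ι-+ a b = ℚ.toℚᵘ-injective (begin
  toℚᵘ (ι (a + b))                      ≈⟨ toℚᵘ-ι (a + b) ⟩
  ℚᵘ.mkℚᵘ (+ (a + b)) 0                 ≈⟨ ℚᵘ.*≡* (cong (ℤ._* + 1) (trans (ℤ.pos-+ a b)
                                             (sym (cong₂ ℤ._+_ (ℤ.*-identityʳ (+ a)) (ℤ.*-identityʳ (+ b)))))) ⟩
  ℚᵘ.mkℚᵘ (+ a) 0 ℚᵘ.+ ℚᵘ.mkℚᵘ (+ b) 0  ≈⟨ ℚᵘ.+-cong (toℚᵘ-ι a) (toℚᵘ-ι b) ⟨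
  toℚᵘ (ι a) ℚᵘ.+ toℚᵘ (ι b)            ≈⟨ ℚ.toℚᵘ-homo-+ (ι a) (ι b) ⟨
  toℚᵘ (ι a ℚ.+ ι b)                    ∎)
  where open ℚᵘ.≃-Reasoning

ι-* : ∀ a b → ι (a * b) ≡ ι a ℚ.* ι b
ι-* a b = ℚ.toℚᵘ-injective (begin
  toℚᵘ (ι (a * b))                      ≈⟨ toℚᵘ-ι (a * b) ⟩
  ℚᵘ.mkℚᵘ (+ (a * b)) 0                 ≈⟨ ℚᵘ.*≡* (cong (ℤ._* + 1) (ℤ.pos-* a b)) ⟩
  ℚᵘ.mkℚᵘ (+ a) 0 ℚᵘ.* ℚᵘ.mkℚᵘ (+ b) 0  ≈⟨ ℚᵘ.*-cong (toℚᵘ-ι a) (toℚᵘ-ι b) ⟨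
  toℚᵘ (ι a) ℚᵘ.* toℚᵘ (ι b)            ≈⟨ ℚ.toℚᵘ-homo-* (ι a) (ι b) ⟨
  toℚᵘ (ι a ℚ.* ι b)                    ∎)
  where open ℚᵘ.≃-Reasoning

ι-mono-≤ : ∀ {a b} → a ≤ b → ι a ℚ.≤ ι b
ι-mono-≤ {a} {b} a≤b = ℚ.toℚᵘ-cancel-≤
  (ℚᵘ.≤-respˡ-≃ (ℚᵘ.≃-sym (toℚᵘ-ι a)) (ℚᵘ.≤-respʳ-≃ (ℚᵘ.≃-sym (toℚᵘ-ι b))
    (ℚᵘ.*≤* (ℤ.*-monoʳ-≤-nonNeg (+ 1) (ℤ.+≤+ a≤b)))))

/2≡*½ : ∀ n → + n ℚ./ 2 ≡ ι n ℚ.* ½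
/2≡*½ n = ℚ.toℚᵘ-injective (begin
  toℚᵘ (+ n ℚ./ 2)             ≈⟨ ℚ.toℚᵘ-fromℚᵘ (ℚᵘ.mkℚᵘ (+ n) 1) ⟩
  ℚᵘ.mkℚᵘ (+ n) 1              ≈⟨ ℚᵘ.*≡* (cong (ℤ._* + 2) (sym (ℤ.*-identityʳ (+ n)))) ⟩
  ℚᵘ.mkℚᵘ (+ n) 0 ℚᵘ.* toℚᵘ ½  ≈⟨ ℚᵘ.*-congʳ (toℚᵘ-ι n) ⟨
  toℚᵘ (ι n) ℚᵘ.* toℚᵘ ½       ≈⟨ ℚ.toℚᵘ-homo-* (ι n) ½ ⟨
  toℚᵘ (ι n ℚ.* ½)             ∎)
  where open ℚᵘ.≃-Reasoning

σ-as-ι : ∀ gs s → σ gs s ≡ ι s ℚ.* ½ - ι (countUpTo gs s) ℚ.+ 1ℚ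
σ-as-ι gs s = cong (λ x → x - ι (countUpTo gs s) ℚ.+ 1ℚ) (/2≡*½ s)

*½-trade : ∀ s y N → ι s ℚ.* ½ - y ≡ ι (s + 2 * N) ℚ.* ½ - (y ℚ.+ ι N)
*½-trade s y N = begin
  ι s ℚ.* ½ - y                                  ≡⟨ regroup (ι s) y (ι N) ½ ⟩
  (ι s ℚ.+ ι 2 ℚ.* ι N) ℚ.* ½ - (y ℚ.+ ι N) ℚ.+ ι N ℚ.* (1ℚ - (½ ℚ.+ ½))
                                                 ≡⟨ cong ((ι s ℚ.+ ι 2 ℚ.* ι N) ℚ.* ½ - (y ℚ.+ ι N) ℚ.+_) (ℚ.*-zeroʳ (ι N)) ⟩
  (ι s ℚ.+ ι 2 ℚ.* ι N) ℚ.* ½ - (y ℚ.+ ι N) ℚ.+ ℚ.0ℚ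
                                                 ≡⟨ ℚ.+-identityʳ _ ⟩
  (ι s ℚ.+ ι 2 ℚ.* ι N) ℚ.* ½ - (y ℚ.+ ι N)      ≡⟨ cong (λ x → x ℚ.* ½ - (y ℚ.+ ι N)) ι[s+2N] ⟨
  ι (s + 2 * N) ℚ.* ½ - (y ℚ.+ ι N)              ∎
  where
  open ≡-Reasoning
  open +-*-Solver
  -- The solver treats u as a variable; that ½ + ½ is 1 is then supplied by computation.
  regroup : ∀ x y z u → x ℚ.* u - y ≡ (x ℚ.+ ι 2 ℚ.* z) ℚ.* u - (y ℚ.+ z) ℚ.+ z ℚ.* (1ℚ - (u ℚ.+ u))
  regroup = solve 4 (λ x y z u → x :* u :- y
                       := (x :+ con (ι 2) :* z) :* u :- (y :+ z) :+ z :* (con 1ℚ :- (u :+ u))) refl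
  ι[s+2N] : ι (s + 2 * N) ≡ ι s ℚ.+ ι 2 ℚ.* ι N
  ι[s+2N] = trans (ι-+ s (2 * N)) (cong (ι s ℚ.+_) (ι-* 2 N))

σ-mono : ∀ gs {s₁ s₂} → s₁ + 2 * countUpTo gs s₂ ≤ s₂ + 2 * countUpTo gs s₁ →
         σ gs s₁ ℚ.≤ σ gs s₂
σ-mono gs {s₁} {s₂} le = begin
  σ gs s₁                                          ≡⟨ σ-as-ι gs s₁ ⟩
  ι s₁ ℚ.* ½ - ι N₁ ℚ.+ 1ℚ                         ≡⟨ cong (ℚ._+ 1ℚ) (*½-trade s₁ (ι N₁) N₂) ⟩
  ι (s₁ + 2 * N₂) ℚ.* ½ - (ι N₁ ℚ.+ ι N₂) ℚ.+ 1ℚ  ≤⟨ ℚ.+-monoˡ-≤ 1ℚ (ℚ.+-monoˡ-≤ (ℚ.- (ι N₁ ℚ.+ ι N₂))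
                                                        (ℚ.*-monoʳ-≤-nonNeg ½ (ι-mono-≤ le))) ⟩
  ι (s₂ + 2 * N₁) ℚ.* ½ - (ι N₁ ℚ.+ ι N₂) ℚ.+ 1ℚ  ≡⟨ cong (λ y → ι (s₂ + 2 * N₁) ℚ.* ½ - y ℚ.+ 1ℚ)
                                                        (ℚ.+-comm (ι N₁) (ι N₂)) ⟩
  ι (s₂ + 2 * N₁) ℚ.* ½ - (ι N₂ ℚ.+ ι N₁) ℚ.+ 1ℚ  ≡⟨ cong (ℚ._+ 1ℚ) (*½-trade s₂ (ι N₂) N₁) ⟨
  ι s₂ ℚ.* ½ - ι N₂ ℚ.+ 1ℚ                         ≡⟨ σ-as-ι gs s₂ ⟨
  σ gs s₂                                          ∎
  where
  open ℚ.≤-Reasoning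
  N₁ = countUpTo gs s₁
  N₂ = countUpTo gs s₂

ceilDiv-*-≥ : ∀ a b .{{_ : NonZero b}} → a ≤ ceilDiv a b * b
ceilDiv-*-≥ a (suc b) = +-cancelʳ-≤ b a (c * suc b) (begin
  a + b                        ≡⟨ m≡m%n+[m/n]*n (a + b) (suc b) ⟩
  (a + b) % suc b + c * suc b  ≤⟨ +-monoˡ-≤ (c * suc b) (≤-pred (m%n<n (a + b) (suc b))) ⟩
  b + c * suc b                ≡⟨ +-comm b (c * suc b) ⟩
  c * suc b + b                ∎)
  where
  open ≤-Reasoning
  c = ceilDiv a (suc b)

<ceilDiv⇒*< : ∀ a b .{{_ : NonZero b}} k → k < ceilDiv a b → k * b < a
<ceilDiv⇒*< a (suc b) k k<c = +-cancelʳ-≤ b (suc (k * suc b)) a (begin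
  suc (k * suc b) + b    ≡⟨ cong suc (+-comm (k * suc b) b) ⟩
  suc k * suc b          ≤⟨ *-monoˡ-≤ (suc b) k<c ⟩
  c * suc b              ≤⟨ m/n*n≤m (a + b) (suc b) ⟩
  a + b                  ∎)
  where
  open ≤-Reasoning
  c = ceilDiv a (suc b)

quotient-bracket : ∀ n h .{{_ : NonZero h}} → ∃ λ q → q * h ≤ n × n < suc q * h
quotient-bracket n h = n / h , m/n*n≤m n h , (begin-strict
  n                      ≡⟨ m≡m%n+[m/n]*n n h ⟩
  n % h + n / h * h      <⟨ +-monoˡ-< (n / h * h) (m%n<n n h) ⟩
  suc (n / h) * h        ∎)
  where open ≤-Reasoning

C2-suc : ∀ n → suc n C 2 ≡ n + n C 2
C2-suc n = trans (sym (nCk+nC[k+1]≡[n+1]C[k+1] n 1)) (cong (_+ n C 2) (nC1≡n n))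

-- k ↦ k a − c C(k,2) has increments a − c k, so it is maximal at the least lam with a ≤ lam c.
module _ {a c lam : ℕ} (a≤lam*c : a ≤ lam * c) (lam-least : ∀ j → j < lam → j * c < a) where

  private
    suc-*-+ : ∀ n x → suc n * a + x ≡ (n * a + x) + a
    suc-*-+ n x = shuffle n a x
      where
      shuffle : ∀ n a x → suc n * a + x ≡ (n * a + x) + a
      shuffle = solve-∀

    +-*-C2-suc : ∀ x n → x + c * (suc n C 2) ≡ (x + c * (n C 2)) + c * n
    +-*-C2-suc x n = trans (cong (λ z → x + c * z) (C2-suc n)) (shuffle x c n (n C 2))
      where
      shuffle : ∀ x c n y → x + c * (n + y) ≡ (x + c * y) + c * n
      shuffle = solve-∀

    ascend : ∀ j k → j + k ≤ lam → k * a + c * ((j + k) C 2) ≤ (j + k) * a + c * (k C 2)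
    ascend zero    k _  = ≤-refl
    ascend (suc j) k le = subst₂ _≤_ (sym (+-*-C2-suc (k * a) (j + k))) (sym (suc-*-+ (j + k) (c * (k C 2))))
      (+-mono-≤ (ascend j k (<⇒≤ le)) (subst (_≤ a) (*-comm (j + k) c) (<⇒≤ (lam-least (j + k) le))))

    descend : ∀ j → (j + lam) * a + c * (lam C 2) ≤ lam * a + c * ((j + lam) C 2)
    descend zero    = ≤-refl
    descend (suc j) = subst₂ _≤_ (sym (suc-*-+ (j + lam) (c * (lam C 2)))) (sym (+-*-C2-suc (lam * a) (j + lam)))
      (+-mono-≤ (descend j) (≤-trans a≤lam*c (subst (lam * c ≤_) (*-comm (j + lam) c) (*-monoˡ-≤ c (m≤n+m lam j)))))

  *-+-C2-maximal : ∀ k → k * a + c * (lam C 2) ≤ lam * a + c * (k C 2)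
  *-+-C2-maximal k with ≤-total k lam
  ... | inj₁ k≤lam = subst (λ n → k * a + c * (n C 2) ≤ n * a + c * (k C 2)) (m∸n+n≡m k≤lam)
                       (ascend (lam ∸ k) k (≤-reflexive (m∸n+n≡m k≤lam)))
  ... | inj₂ lam≤k = subst (λ n → n * a + c * (lam C 2) ≤ lam * a + c * (n C 2)) (m∸n+n≡m lam≤k)
                       (descend (k ∸ lam))

module _ {p} {P : Pred ℕ p} (P? : Decidable P) where

  countBelow : ℕ → ℕ
  countBelow n = length (filter P? (upTo n))

  private
    countBelow-suc : ∀ n → countBelow (suc n) ≡ countBelow n + length (filter P? (n ∷ []))
    countBelow-suc n = trans (cong (length ∘ filter P?) (sym (upTo-∷ʳ n)))
      (trans (cong length (filter-++ P? (upTo n) (n ∷ []))) (length-++ (filter P? (upTo n))))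

  countBelow-+-all : ∀ a t → (∀ i → i < t → P (a + i)) → countBelow (a + t) ≡ countBelow a + t
  countBelow-+-all a zero    _   = trans (cong countBelow (+-identityʳ a)) (sym (+-identityʳ _))
  countBelow-+-all a (suc t) all = begin
    countBelow (a + suc t)                                ≡⟨ cong countBelow (+-suc a t) ⟩
    countBelow (suc (a + t))                              ≡⟨ countBelow-suc (a + t) ⟩
    countBelow (a + t) + length (filter P? (a + t ∷ []))  ≡⟨ cong₂ _+_ (countBelow-+-all a t (λ i → all i ∘ m<n⇒m<1+n))
                                                               (cong length (filter-accept P? (all t ≤-refl))) ⟩
    countBelow a + t + 1                                  ≡⟨ trans (+-assoc _ t 1) (cong (λ x → countBelow a + x) (+-comm t 1)) ⟩
    countBelow a + suc t                                  ∎
    where open ≡-Reasoning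

  countBelow-+-none : ∀ a t → (∀ i → i < t → ¬ P (a + i)) → countBelow (a + t) ≡ countBelow a
  countBelow-+-none a zero    _    = cong countBelow (+-identityʳ a)
  countBelow-+-none a (suc t) none = begin
    countBelow (a + suc t)                                ≡⟨ cong countBelow (+-suc a t) ⟩
    countBelow (suc (a + t))                              ≡⟨ countBelow-suc (a + t) ⟩
    countBelow (a + t) + length (filter P? (a + t ∷ []))  ≡⟨ cong₂ _+_ (countBelow-+-none a t (λ i → none i ∘ m<n⇒m<1+n))
                                                               (cong length (filter-reject P? (none t ≤-refl))) ⟩
    countBelow a + 0                                      ≡⟨ +-identityʳ _ ⟩
    countBelow a                                          ∎
    where open ≡-Reasoning

module _ (m h : ℕ) where

  private
    S = intervalGens m h
    count = countBelow (_∈⟨ S ⟩?)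

  ∈-intervalGens⁺ : ∀ k t → t ≤ k * h → (k * m + t) ∈⟨ S ⟩
  ∈-intervalGens⁺ zero    zero _ = zero∈
  ∈-intervalGens⁺ (suc k) t t≤ with t ≤? h
  ... | yes t≤h = subst (_∈⟨ S ⟩) (shuffle k m t)
                    (step (∈-applyUpTo⁺ (_+_ m) (s≤s t≤h)) (∈-intervalGens⁺ k 0 z≤n))
    where
    shuffle : ∀ k m t → m + t + (k * m + 0) ≡ suc k * m + t
    shuffle = solve-∀
  ... | no t≰h = subst (_∈⟨ S ⟩) (trans (shuffle k m h (t ∸ h)) (cong (_+_ (suc k * m)) (m+[n∸m]≡n h≤t)))
                    (step (∈-applyUpTo⁺ (_+_ m) (s≤s (≤-refl {h}))) (∈-intervalGens⁺ k (t ∸ h) t∸h≤k*h))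
    where
    h≤t = <⇒≤ (≰⇒> t≰h)
    t∸h≤k*h : t ∸ h ≤ k * h
    t∸h≤k*h = +-cancelˡ-≤ h (t ∸ h) (k * h) (subst (_≤ h + k * h) (sym (m+[n∸m]≡n h≤t)) t≤)
    shuffle : ∀ k m h t' → m + h + (k * m + t') ≡ suc k * m + (h + t')
    shuffle = solve-∀

  ∈-intervalGens⁻ : ∀ {x} → x ∈⟨ S ⟩ → ∃₂ λ k t → t ≤ k * h × k * m + t ≡ x
  ∈-intervalGens⁻ zero∈ = 0 , 0 , z≤n , refl
  ∈-intervalGens⁻ (step g∈ x∈) with ∈-applyUpTo⁻ (_+_ m) g∈ | ∈-intervalGens⁻ x∈
  ... | i , i<1+h , refl | k , t , t≤ , refl = suc k , i + t , +-mono-≤ (≤-pred i<1+h) t≤ , shuffle k m i t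
    where
    shuffle : ∀ k m i t → suc k * m + (i + t) ≡ m + i + (k * m + t)
    shuffle = solve-∀

  ∉-intervalGens : ∀ j {x} → j * m + j * h < x → x < suc j * m → ¬ x ∈⟨ S ⟩
  ∉-intervalGens j lo hi x∈ with ∈-intervalGens⁻ x∈
  ... | k , t , t≤ , refl with k ≤? j
  ...   | yes k≤j = <-irrefl refl (≤-<-trans (+-mono-≤ (*-monoˡ-≤ m k≤j) (≤-trans t≤ (*-monoˡ-≤ h k≤j))) lo)
  ...   | no  k≰j = <-irrefl refl (<-≤-trans hi (≤-trans (*-monoˡ-≤ m (≰⇒> k≰j)) (m≤m+n (k * m) t)))

  private
    gap-below-next-level : ∀ j {i} → j * h < m → i < m ∸ suc (j * h) → j * m + suc (j * h) + i < suc j * m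
    gap-below-next-level j {i} jh<m i<gap = begin-strict
      j * m + suc (j * h) + i                   ≡⟨ +-assoc (j * m) _ i ⟩
      j * m + (suc (j * h) + i)                 <⟨ +-monoʳ-< (j * m) (+-monoʳ-< (suc (j * h)) i<gap) ⟩
      j * m + (suc (j * h) + (m ∸ suc (j * h))) ≡⟨ cong (_+_ (j * m)) (m+[n∸m]≡n jh<m) ⟩
      j * m + m                                 ≡⟨ +-comm (j * m) m ⟩
      suc j * m                                 ∎
      where open ≤-Reasoning

  -- Level j of S is the block j m, …, j m + j h, followed by a gap up to (j + 1) m.
  countBelow-level-suc : ∀ j → j * h < m → count (suc j * m) ≡ count (j * m) + suc (j * h)
  countBelow-level-suc j jh<m = begin
    count (suc j * m)                   ≡⟨ cong count split ⟩
    count (j * m + suc (j * h) + gap)   ≡⟨ countBelow-+-none (_∈⟨ S ⟩?) _ gap in-gap ⟩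
    count (j * m + suc (j * h))         ≡⟨ countBelow-+-all (_∈⟨ S ⟩?) (j * m) _ (λ i i≤jh → ∈-intervalGens⁺ j i (≤-pred i≤jh)) ⟩
    count (j * m) + suc (j * h)         ∎
    where
    open ≡-Reasoning
    gap = m ∸ suc (j * h)
    split : suc j * m ≡ j * m + suc (j * h) + gap
    split = trans (cong (_+ j * m) (sym (m+[n∸m]≡n jh<m)))
                  (trans (+-comm (suc (j * h) + gap) (j * m)) (sym (+-assoc (j * m) _ gap)))
    in-gap : ∀ i → i < gap → ¬ (j * m + suc (j * h) + i) ∈⟨ S ⟩
    in-gap i i<gap = ∉-intervalGens j (≤-trans (≤-reflexive (sym (+-suc (j * m) (j * h)))) (m≤m+n _ i))
                                      (gap-below-next-level j jh<m i<gap)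

  countBelow-level : ∀ k → (∀ j → j < k → j * h < m) → count (k * m) ≡ k + h * (k C 2)
  countBelow-level zero    _     = sym (*-zeroʳ h)
  countBelow-level (suc k) below = begin
    count (suc k * m)                   ≡⟨ countBelow-level-suc k (below k ≤-refl) ⟩
    count (k * m) + suc (k * h)         ≡⟨ cong (_+ suc (k * h)) (countBelow-level k (λ j → below j ∘ m<n⇒m<1+n)) ⟩
    k + h * (k C 2) + suc (k * h)       ≡⟨ shuffle k h (k C 2) ⟩
    suc k + h * (k + k C 2)             ≡⟨ cong (λ x → suc k + h * x) (C2-suc k) ⟨
    suc k + h * (suc k C 2)             ∎
    where
    open ≡-Reasoning
    shuffle : ∀ k h c → k + h * c + suc (k * h) ≡ suc k + h * (k + c)
    shuffle = solve-∀

  countUpTo-intervalGens : ∀ k t → (∀ j → j < k → j * h < m) → t ≤ k * h →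
                           countUpTo S (k * m + t) ≡ k + h * (k C 2) + suc t
  countUpTo-intervalGens k t below t≤ = begin
    count (suc (k * m + t))             ≡⟨ cong count (+-suc (k * m) t) ⟨
    count (k * m + suc t)               ≡⟨ countBelow-+-all (_∈⟨ S ⟩?) (k * m) (suc t)
                                             (λ i i≤t → ∈-intervalGens⁺ k i (≤-trans (≤-pred i≤t) t≤)) ⟩
    count (k * m) + suc t               ≡⟨ cong (_+ suc t) (countBelow-level k below) ⟩
    k + h * (k C 2) + suc t             ∎
    where open ≡-Reasoning

frobenius-intervalGens : ∀ {n h q} → q * h < n → n ≤ suc q * h →
                         IsFrobenius (intervalGens (suc n) h) (q * suc n + n)
frobenius-intervalGens {n} {h} {q} q*h<n n≤ = F∉ , above
  where
  F∉ = ∉-intervalGens (suc n) h q (+-monoʳ-< (q * suc n) q*h<n)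
         (subst (q * suc n + n <_) (+-comm (q * suc n) (suc n)) (+-monoʳ-< (q * suc n) ≤-refl))
  above : ∀ x → q * suc n + n < x → x ∈⟨ intervalGens (suc n) h ⟩
  above x F<x = subst (_∈⟨ _ ⟩) (trans (+-comm (k * suc n) _) (sym (m≡m%n+[m/n]*n x (suc n))))
                  (∈-intervalGens⁺ (suc n) h k (x % suc n) r≤k*h)
    where
    k = x / suc n
    suc-q≤k : suc q ≤ k
    suc-q≤k = subst (_≤ k) (m*n/n≡m (suc q) (suc n))
                (/-monoˡ-≤ (suc n) (subst (_≤ x) (cong suc (+-comm (q * suc n) n)) F<x))
    r≤k*h : x % suc n ≤ k * h
    r≤k*h = ≤-trans (≤-pred (m%n<n x (suc n))) (≤-trans n≤ (*-monoˡ-≤ h suc-q≤k))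

-- m = a + 2, q = ⌈(m − 1)/h⌉ − 1 and lam = ⌈(m − 2)/2h⌉.
module Maximiser {a h q lam : ℕ} (q*h<1+a : q * h < suc a) (1+a≤ : suc a ≤ suc q * h)
                 (a≤lam*2h : a ≤ lam * (2 * h)) (lam-least : ∀ j → j < lam → j * (2 * h) < a) where

  private
    m = suc (suc a)
    S = intervalGens m h
    F = q * m + suc a

    suc-F≡ : suc F ≡ suc q * m
    suc-F≡ = shuffle q a
      where
      shuffle : ∀ q a → suc (q * suc (suc a) + suc a) ≡ suc q * suc (suc a)
      shuffle = solve-∀

    lam≤suc-q : lam ≤ suc q
    lam≤suc-q = ≮⇒≥ λ suc-q<lam → <-asym (lam-least (suc q) suc-q<lam) (begin-strict
      a                  <⟨ n<1+n a ⟩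
      suc a              ≤⟨ 1+a≤ ⟩
      suc q * h          ≤⟨ *-monoʳ-≤ (suc q) (m≤m+n h (h + 0)) ⟩
      suc q * (2 * h)    ∎)
      where open ≤-Reasoning

    count-at : ∀ k t → k ≤ suc q → t ≤ k * h → countUpTo S (k * m + t) ≡ k + h * (k C 2) + suc t
    count-at k t k≤ = countUpTo-intervalGens m h k t
      (λ j j<k → ≤-<-trans (*-monoˡ-≤ h (≤-pred (<-≤-trans j<k k≤))) (m<n⇒m<1+n q*h<1+a))

    count-at-lam : countUpTo S (lam * m) ≡ lam + h * (lam C 2) + 1
    count-at-lam = trans (cong (countUpTo S) (sym (+-identityʳ (lam * m)))) (count-at lam 0 lam≤suc-q z≤n)

    σ-comparison : ∀ k t → k * m + t + 2 * (lam + h * (lam C 2) + 1) ≤ lam * m + 2 * (k + h * (k C 2) + suc t)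
    σ-comparison k t = subst₂ _≤_ (sym (lhs k t lam a h (lam C 2))) (sym (rhs k t lam a h (k C 2)))
      (≤-trans (+-monoˡ-≤ _ (*-+-C2-maximal a≤lam*2h lam-least k)) (m≤m+n _ t))
      where
      lhs : ∀ k t lam a h cl → k * suc (suc a) + t + 2 * (lam + h * cl + 1)
                             ≡ (k * a + (2 * h) * cl) + (2 * k + t + 2 * lam + 2)
      lhs = solve-∀
      rhs : ∀ k t lam a h ck → lam * suc (suc a) + 2 * (k + h * ck + suc t)
                             ≡ (lam * a + (2 * h) * ck) + (2 * k + t + 2 * lam + 2) + t
      rhs = solve-∀

  lam*m∈S : (lam * m) ∈⟨ S ⟩
  lam*m∈S = subst (_∈⟨ S ⟩) (+-identityʳ (lam * m)) (∈-intervalGens⁺ m h lam 0 z≤n)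

  lam*m≤conductor : lam * m ≤ suc F
  lam*m≤conductor = subst (lam * m ≤_) (sym suc-F≡) (*-monoˡ-≤ m lam≤suc-q)

  σ-max : ∀ s → s ∈⟨ S ⟩ → s ≤ suc F → σ S s ℚ.≤ σ S (lam * m)
  σ-max s s∈ s≤ with ∈-intervalGens⁻ m h s∈
  ... | k , t , t≤ , refl = σ-mono S {k * m + t} {lam * m} (subst₂ (λ A B → k * m + t + 2 * A ≤ lam * m + 2 * B)
                              (sym count-at-lam) (sym (count-at k t k≤suc-q t≤)) (σ-comparison k t))
    where
    k≤suc-q : k ≤ suc q
    k≤suc-q = *-cancelʳ-≤ k (suc q) m (≤-trans (m≤m+n (k * m) t) (subst (k * m + t ≤_) suc-F≡ s≤))

  σ-lam*m : σ S (lam * m) ≡ (+ lam ℚ./ 1) ℚ.* ((+ m ℚ./ 2) - 1ℚ) - (+ (h * (lam C 2)) ℚ./ 1)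
  σ-lam*m = begin
    σ S (lam * m)                                                   ≡⟨ σ-as-ι S (lam * m) ⟩
    ι (lam * m) ℚ.* ½ - ι (countUpTo S (lam * m)) ℚ.+ 1ℚ            ≡⟨ cong₂ (λ x y → x ℚ.* ½ - y ℚ.+ 1ℚ) (ι-* lam m) ι[count] ⟩
    ι lam ℚ.* ι m ℚ.* ½ - (ι lam ℚ.+ ι h ℚ.* ι (lam C 2) ℚ.+ 1ℚ) ℚ.+ 1ℚ
                                                                    ≡⟨ rearrange (ι lam) (ι m) (ι h) (ι (lam C 2)) ½ ⟩
    ι lam ℚ.* (ι m ℚ.* ½ - 1ℚ) - ι h ℚ.* ι (lam C 2)               ≡⟨ cong₂ (λ x y → ι lam ℚ.* (x - 1ℚ) - y) (/2≡*½ m) (ι-* h (lam C 2)) ⟨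
    ι lam ℚ.* (+ m ℚ./ 2 - 1ℚ) - ι (h * (lam C 2))                  ∎
    where
    open ≡-Reasoning
    open +-*-Solver
    ι[count] : ι (countUpTo S (lam * m)) ≡ ι lam ℚ.+ ι h ℚ.* ι (lam C 2) ℚ.+ 1ℚ
    ι[count] = trans (cong ι count-at-lam) (trans (ι-+ (lam + h * (lam C 2)) 1)
                 (cong (ℚ._+ 1ℚ) (trans (ι-+ lam (h * (lam C 2))) (cong (ι lam ℚ.+_) (ι-* h (lam C 2))))))
    rearrange : ∀ l m h c u → l ℚ.* m ℚ.* u - (l ℚ.+ h ℚ.* c ℚ.+ 1ℚ) ℚ.+ 1ℚ ≡ l ℚ.* (m ℚ.* u - 1ℚ) - h ℚ.* c
    rearrange = solve 5 (λ l m h c u → l :* m :* u :- (l :+ h :* c :+ con 1ℚ) :+ con 1ℚ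
                                     := l :* (m :* u :- con 1ℚ) :- h :* c) refl

corollary3p4 : (m h : ℕ) → 2 ≤ m → 1 ≤ h → h ≤ m ∸ 1 →
  let S = intervalGens m h
      lam = ceilDiv (m ∸ 2) (2 Data.Nat.* h)
  in Σ ℕ λ F → IsFrobenius S F
       × (lam Data.Nat.* m) ∈⟨ S ⟩
       × lam Data.Nat.* m ≤ suc F
       × (∀ s → s ∈⟨ S ⟩ → s ≤ suc F → σ S s Data.Rational.≤ σ S (lam Data.Nat.* m))
       × σ S (lam Data.Nat.* m)
           ≡ (((+ lam) Data.Rational./ 1) Data.Rational.* (((+ m) Data.Rational./ 2) - 1ℚ))
             - ((+ (h Data.Nat.* (lam C 2))) Data.Rational./ 1)
corollary3p4 (suc (suc a)) (suc h') (s≤s (s≤s z≤n)) (s≤s z≤n) _ =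
  let q , q*h≤a , a<suc-q*h = quotient-bracket a (suc h')
      open Maximiser {a} {suc h'} {q} {ceilDiv a (2 * suc h')}
             (s≤s q*h≤a) a<suc-q*h (ceilDiv-*-≥ a (2 * suc h')) (<ceilDiv⇒*< a (2 * suc h'))
  in  q * suc (suc a) + suc a , frobenius-intervalGens {suc a} {suc h'} {q} (s≤s q*h≤a) a<suc-q*h ,
      lam*m∈S , lam*m≤conductor , σ-max , σ-lam*m
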